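{- Let $\mathsf P$ be a grounded Petri net with initial marking $B$. Then (1) every morphism of $B$-$\mathsf P$-processes is injective, and (2) a $B$-$\mathsf P$-process has no non-trivial automorphisms.
   Context: A Petri net is a diagram of finite sets $S\leftarrow I\to T\leftarrow O\to S$; it is grounded if $I\to T$ is surjective. A graph is a diagram of finite sets $A\leftarrow I_G\to N\leftarrow O_G\to A$ with injective outer maps; acyclic means no directed cycles of nodes; its in-boundary is the set of edges not in the image of $O_G\to A$. Morphisms of such diagrams are maps on the four sets commuting with the structure (same map on both outer copies), etale if the two middle squares are pullbacks. For a finite set $B$, $\mathsf B=B\emptyset\emptyset\emptyset B$, and an initial marking is a map $B\to S$. A $B$-$\mathsf P$-process is a commutative triangle of etale maps $\mathsf B\to\mathsf G\to\mathsf P$ with $\mathsf G$ an acyclic graph and $\mathsf B\to\mathsf G$ a bijection onto the in-boundary of $\mathsf G$. A morphism of $B$-$\mathsf P$-processes is an etale map $\mathsf G\to\mathsf G'$ commuting with the maps to $\mathsf P$ and inducing a bijection of in-boundaries compatible with the maps from $\mathsf B$. -}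

module Defs where

open import Data.Nat using (ℕ)
open import Data.Fin using (Fin)
open import Data.Product using (Σ; Σ-syntax; ∃; ∃-syntax; _×_; _,_)
open import Data.Empty using (⊥)
open import Relation.Nullary using (¬_)
open import Relation.Binary.PropositionalEquality using (_≡_)

-- Diagrams of finite sets  S ← I → T ← O → S
-- (finite sets are represented as Fin n)

record Diagram : Set where
  field
    nS nI nT nO : ℕ
    inS  : Fin nI → Fin nS
    inT  : Fin nI → Fin nT
    outT : Fin nO → Fin nT
    outS : Fin nO → Fin nS
open Diagram public

-- A Petri net is just such a diagram.  Grounded: I → T surjective.
Grounded : Diagram → Set
Grounded P = ∀ (t : Fin (nT P)) → ∃[ i ] inT P i ≡ t

Injective : {m n : ℕ} → (Fin m → Fin n) → Set
Injective f = ∀ x y → f x ≡ f y → x ≡ y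

-- Graphs: A ← I_G → N ← O_G → A with injective outer maps.
-- (A = nS, N = nT.)

record IsGraph (G : Diagram) : Set where
  field
    inS-inj  : Injective (inS G)
    outS-inj : Injective (outS G)

Step : (G : Diagram) → Fin (nT G) → Fin (nT G) → Set
Step G n m = Σ[ o ∈ Fin (nO G) ] Σ[ i ∈ Fin (nI G) ]
  (outT G o ≡ n × inT G i ≡ m × outS G o ≡ inS G i)

data Path⁺ (G : Diagram) : Fin (nT G) → Fin (nT G) → Set where
  one  : ∀ {n m} → Step G n m → Path⁺ G n m
  cons : ∀ {n m k} → Step G n m → Path⁺ G m k → Path⁺ G n k

Acyclic : Diagram → Set
Acyclic G = ∀ n → ¬ Path⁺ G n n

InBoundary : (G : Diagram) → Fin (nS G) → Set
InBoundary G a = ¬ (∃[ o ] outS G o ≡ a)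

record Hom (X Y : Diagram) : Set where
  field
    fS : Fin (nS X) → Fin (nS Y)
    fI : Fin (nI X) → Fin (nI Y)
    fT : Fin (nT X) → Fin (nT Y)
    fO : Fin (nO X) → Fin (nO Y)
    inS-comm  : ∀ i → fS (inS X i) ≡ inS Y (fI i)
    inT-comm  : ∀ i → fT (inT X i) ≡ inT Y (fI i)
    outT-comm : ∀ o → fT (outT X o) ≡ outT Y (fO o)
    outS-comm : ∀ o → fS (outS X o) ≡ outS Y (fO o)
open Hom public

-- Etale: both middle squares are pullbacks, i.e. the canonical maps
-- I → T ×_{T'} I'  and  O → T ×_{T'} O'  are bijections.
record IsEtale {X Y : Diagram} (h : Hom X Y) : Set where
  field
    I-exists : ∀ (t : Fin (nT X)) (i' : Fin (nI Y)) → fT h t ≡ inT Y i' →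
               ∃[ i ] (inT X i ≡ t × fI h i ≡ i')
    I-unique : ∀ (i j : Fin (nI X)) → inT X i ≡ inT X j → fI h i ≡ fI h j → i ≡ j
    O-exists : ∀ (t : Fin (nT X)) (o' : Fin (nO Y)) → fT h t ≡ outT Y o' →
               ∃[ o ] (outT X o ≡ t × fO h o ≡ o')
    O-unique : ∀ (o p : Fin (nO X)) → outT X o ≡ outT X p → fO h o ≡ fO h p → o ≡ p

-- Here B = Fin nB, 𝖡 = B∅∅∅B, and the initial marking is
-- m : B → S.  A map 𝖡 → 𝖦 is just a map B → A (the other components are
-- from ∅, and it is automatically etale); the triangle commutes iff the
-- A-component composed with the S-component of 𝖦 → 𝖯 equals m.

record Process (P : Diagram) (nB : ℕ) (m : Fin nB → Fin (nS P)) : Set where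
  field
    G       : Diagram
    isGraph : IsGraph G
    acyclic : Acyclic G
    g       : Hom G P
    g-etale : IsEtale g
    b       : Fin nB → Fin (nS G)
    b-inj   : Injective b
    b-into  : ∀ x → InBoundary G (b x)
    b-onto  : ∀ a → InBoundary G a → ∃[ x ] b x ≡ a
    triangle : ∀ x → fS g (b x) ≡ m x
open Process public

record ProcHom {P : Diagram} {nB : ℕ} {m : Fin nB → Fin (nS P)}
               (X Y : Process P nB m) : Set where
  field
    h       : Hom (G X) (G Y)
    h-etale : IsEtale h
    overS : ∀ a → fS (g Y) (fS h a) ≡ fS (g X) a
    overI : ∀ i → fI (g Y) (fI h i) ≡ fI (g X) i
    overT : ∀ t → fT (g Y) (fT h t) ≡ fT (g X) t
    overO : ∀ o → fO (g Y) (fO h o) ≡ fO (g X) o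
    inb-into : ∀ a → InBoundary (G X) a → InBoundary (G Y) (fS h a)
    inb-onto : ∀ a' → InBoundary (G Y) a' →
               ∃[ a ] (InBoundary (G X) a × fS h a ≡ a')
    compat : ∀ x → fS h (b X x) ≡ b Y x
open ProcHom public

InjectiveHom : {X Y : Diagram} → Hom X Y → Set
InjectiveHom h = Injective (fS h) × Injective (fI h) × Injective (fT h) × Injective (fO h)

IsIdentityHom : {X : Diagram} → Hom X X → Set
IsIdentityHom h = (∀ a → fS h a ≡ a) × (∀ i → fI h i ≡ i) × (∀ t → fT h t ≡ t) × (∀ o → fO h o ≡ o)

LeftInverse : {X Y : Diagram} → Hom Y X → Hom X Y → Set
LeftInverse k h = (∀ a → fS k (fS h a) ≡ a) × (∀ i → fI k (fI h i) ≡ i)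
                × (∀ t → fT k (fT h t) ≡ t) × (∀ o → fO k (fO h o) ≡ o)

IsAutomorphism : {P : Diagram} {nB : ℕ} {m : Fin nB → Fin (nS P)}
                 {X : Process P nB m} → ProcHom X X → Set
IsAutomorphism {X = X} φ = Σ[ ψ ∈ ProcHom X X ]
  (LeftInverse (h ψ) (h φ) × LeftInverse (h φ) (h ψ))

module Submission where

open import Defs
open import Data.Nat using (ℕ; suc; _≤′_; ≤′-refl; ≤′-step)
open import Data.Nat.Properties using (n<1+n; <⇒<′)
open import Data.Nat.GeneralisedArithmetic using (fold)
open import Data.Fin using (Fin; toℕ; _≟_; _<_)
open import Data.Fin.Properties using (pigeonhole; any?)
open import Data.Product using (Σ; ∃-syntax; _×_; _,_; proj₁; proj₂)
open import Data.Sum using (_⊎_; inj₁; inj₂)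
open import Data.Empty using (⊥; ⊥-elim)
open import Function using (_∘_)
open import Relation.Nullary using (¬_; yes; no)
open import Relation.Binary.PropositionalEquality
  using (_≡_; _≢_; refl; sym; trans; cong; subst)

-- Groundedness of P forces every transition of a process to have an input
-- edge.  If a morphism collapses two transitions (or two morphisms disagree
-- on one), follow an input edge backwards: etaleness and the fact that
-- in-boundary edges are pinned down by B produce the same defect at an
-- earlier transition.  In a finite acyclic graph such a descent cannot go on
-- forever.

acyclic⇒¬descending : (G : Diagram) → Acyclic G → (Bad : Fin (nT G) → Set) →
  (∀ t → Bad t → ∃[ s ] (Bad s × Step G s t)) → ∀ t → ¬ Bad t
acyclic⇒¬descending G acyclic Bad descend t bad = cycle (pigeonhole (n<1+n (nT G)) (node ∘ toℕ))
  where
  back : Σ (Fin (nT G)) Bad → Σ (Fin (nT G)) Bad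
  back (t , bt) = proj₁ (descend t bt) , proj₁ (proj₂ (descend t bt))

  chain : ℕ → Σ (Fin (nT G)) Bad
  chain = fold (t , bad) back

  node : ℕ → Fin (nT G)
  node k = proj₁ (chain k)

  step : ∀ k → Step G (node (suc k)) (node k)
  step k = proj₂ (proj₂ (descend (node k) (proj₂ (chain k))))

  path : ∀ {i j} → suc i ≤′ j → Path⁺ G (node j) (node i)
  path {i} ≤′-refl        = one (step i)
  path (≤′-step {j} le) = cons (step j) (path le)

  cycle : ∃[ i ] ∃[ j ] (i < j × node (toℕ i) ≡ node (toℕ j)) → ⊥
  cycle (i , j , i<j , same) =
    acyclic (node (toℕ i)) (subst (λ n → Path⁺ G n (node (toℕ i))) (sym same) (path (<⇒<′ i<j)))

etale-reflects-grounded : {X Y : Diagram} {f : Hom X Y} → IsEtale f → Grounded Y → Grounded X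
etale-reflects-grounded {f = f} etale grounded t
  with i' , inT-i'≡ft ← grounded (fT f t)
  with i , inT-i≡t , _ ← IsEtale.I-exists etale t i' (sym inT-i'≡ft)
  = i , inT-i≡t

same-input⇒same-node : {G : Diagram} → IsGraph G → ∀ {i i' t t'} →
  inT G i ≡ t → inT G i' ≡ t' → inS G i ≡ inS G i' → t ≡ t'
same-input⇒same-node {G} graph {i} {i'} refl refl same = cong (inT G) (IsGraph.inS-inj graph i i' same)

module _ {P : Diagram} {nB : ℕ} {m : Fin nB → Fin (nS P)} (X : Process P nB m) where

  output-or-initial : ∀ a → (∃[ o ] outS (G X) o ≡ a) ⊎ (∃[ x ] b X x ≡ a)
  output-or-initial a with any? (λ o → outS (G X) o ≟ a)
  ... | yes output = inj₁ output
  ... | no  ¬output = inj₂ (b-onto X a ¬output)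

  idProcHom : ProcHom X X
  idProcHom = record
    { h        = record
      { fS = λ a → a ; fI = λ i → i ; fT = λ t → t ; fO = λ o → o
      ; inS-comm = λ _ → refl ; inT-comm = λ _ → refl
      ; outT-comm = λ _ → refl ; outS-comm = λ _ → refl }
    ; h-etale  = record
      { I-exists = λ _ i e → i , sym e , refl ; I-unique = λ _ _ _ e → e
      ; O-exists = λ _ o e → o , sym e , refl ; O-unique = λ _ _ _ e → e }
    ; overS = λ _ → refl ; overI = λ _ → refl ; overT = λ _ → refl ; overO = λ _ → refl
    ; inb-into = λ _ inb → inb ; inb-onto = λ a inb → a , inb , refl ; compat = λ _ → refl }

Agree : {X Y : Diagram} → Hom X Y → Hom X Y → Set
Agree f g = (∀ a → fS f a ≡ fS g a) × (∀ i → fI f i ≡ fI g i)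
          × (∀ t → fT f t ≡ fT g t) × (∀ o → fO f o ≡ fO g o)

module _ {P : Diagram} {nB : ℕ} {m : Fin nB → Fin (nS P)} (grounded : Grounded P)
         {X Y : Process P nB m} (φ : ProcHom X Y) where

  private
    F = h φ
    open IsEtale (h-etale φ)

  image-of-output : ∀ {o a} → outS (G X) o ≡ a → fS F a ≡ outS (G Y) (fO F o)
  image-of-output {o} refl = outS-comm F o

  image-of-initial : ∀ {x a} → b X x ≡ a → fS F a ≡ b Y x
  image-of-initial {x} refl = compat φ x

  edge-collision⇒output-collision : ∀ a a' → fS F a ≡ fS F a' → a ≡ a' ⊎
    ∃[ o ] ∃[ o' ] (outS (G X) o ≡ a × outS (G X) o' ≡ a' × fO F o ≡ fO F o')
  edge-collision⇒output-collision a a' same with output-or-initial X a | output-or-initial X a'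
  ... | inj₁ (o , eo) | inj₁ (o' , eo') = inj₂ (o , o' , eo , eo' ,
        IsGraph.outS-inj (isGraph Y) _ _
          (trans (sym (image-of-output eo)) (trans same (image-of-output eo'))))
  ... | inj₂ (x , ex) | inj₂ (x' , ex') = inj₁ (trans (sym ex) (trans
        (cong (b X) (b-inj Y x x' (trans (sym (image-of-initial ex)) (trans same (image-of-initial ex')))))
        ex'))
  ... | inj₂ (x , ex) | inj₁ (o' , eo') = ⊥-elim (b-into Y x (fO F o' ,
        trans (sym (image-of-output eo')) (trans (sym same) (image-of-initial ex))))
  ... | inj₁ (o , eo) | inj₂ (x' , ex') = ⊥-elim (b-into Y x' (fO F o ,
        trans (sym (image-of-output eo)) (trans same (image-of-initial ex'))))

  Collides : Fin (nT (G X)) → Set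
  Collides t = ∃[ t' ] (t ≢ t' × fT F t ≡ fT F t')

  collision-descends : ∀ t → Collides t → ∃[ s ] (Collides s × Step (G X) s t)
  collision-descends t (t' , t≢t' , same)
    with i , inT-i≡t ← etale-reflects-grounded (g-etale X) grounded t
    with i' , inT-i'≡t' , fI-i'≡fI-i ← I-exists t' (fI F i)
           (trans (sym same) (trans (cong (fT F) (sym inT-i≡t)) (inT-comm F i)))
    with edge-collision⇒output-collision (inS (G X) i) (inS (G X) i')
           (trans (inS-comm F i) (trans (cong (inS (G Y)) (sym fI-i'≡fI-i)) (sym (inS-comm F i'))))
  ... | inj₁ same-edge = ⊥-elim (t≢t' (same-input⇒same-node (isGraph X) inT-i≡t inT-i'≡t' same-edge))
  ... | inj₂ (o , o' , eo , eo' , fO-same) =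
        outT (G X) o ,
        (outT (G X) o' , distinct ,
          trans (outT-comm F o) (trans (cong (outT (G Y)) fO-same) (sym (outT-comm F o')))) ,
        (o , i , refl , inT-i≡t , eo)
    where
    distinct : outT (G X) o ≢ outT (G X) o'
    distinct e with refl ← O-unique o o' e fO-same =
      t≢t' (same-input⇒same-node (isGraph X) inT-i≡t inT-i'≡t' (trans (sym eo) eo'))

  injectiveT : Injective (fT F)
  injectiveT t t' same with t ≟ t'
  ... | yes t≡t' = t≡t'
  ... | no  t≢t' = ⊥-elim
        (acyclic⇒¬descending (G X) (acyclic X) Collides collision-descends t (t' , t≢t' , same))

  injectiveI : Injective (fI F)
  injectiveI i i' same = I-unique i i'
    (injectiveT _ _ (trans (inT-comm F i) (trans (cong (inT (G Y)) same) (sym (inT-comm F i'))))) same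

  injectiveO : Injective (fO F)
  injectiveO o o' same = O-unique o o'
    (injectiveT _ _ (trans (outT-comm F o) (trans (cong (outT (G Y)) same) (sym (outT-comm F o'))))) same

  injectiveS : Injective (fS F)
  injectiveS a a' same with edge-collision⇒output-collision a a' same
  ... | inj₁ a≡a' = a≡a'
  ... | inj₂ (o , o' , eo , eo' , fO-same) =
        trans (sym eo) (trans (cong (outS (G X)) (injectiveO o o' fO-same)) eo')

  procHom-injective : InjectiveHom F
  procHom-injective = injectiveS , injectiveI , injectiveT , injectiveO

module _ {P : Diagram} {nB : ℕ} {m : Fin nB → Fin (nS P)} (grounded : Grounded P)
         {X Y : Process P nB m} (φ ψ : ProcHom X Y) where

  private
    F = h φ
    K = h ψ

  agree-on-output : ∀ o → fT F (outT (G X) o) ≡ fT K (outT (G X) o) → fO F o ≡ fO K o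
  agree-on-output o same = IsEtale.O-unique (g-etale Y) (fO F o) (fO K o)
    (trans (sym (outT-comm F o)) (trans same (outT-comm K o)))
    (trans (overO φ o) (sym (overO ψ o)))

  agreeS-on-output : ∀ {o a} → outS (G X) o ≡ a →
    fT F (outT (G X) o) ≡ fT K (outT (G X) o) → fS F a ≡ fS K a
  agreeS-on-output {o} refl same =
    trans (outS-comm F o) (trans (cong (outS (G Y)) (agree-on-output o same)) (sym (outS-comm K o)))

  agreeS-on-initial : ∀ {x a} → b X x ≡ a → fS F a ≡ fS K a
  agreeS-on-initial {x} refl = trans (compat φ x) (sym (compat ψ x))

  agreeI-from-agreeS : ∀ i → fS F (inS (G X) i) ≡ fS K (inS (G X) i) → fI F i ≡ fI K i
  agreeI-from-agreeS i same =
    IsGraph.inS-inj (isGraph Y) _ _ (trans (sym (inS-comm F i)) (trans same (inS-comm K i)))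

  agreeT-from-agreeI : ∀ {i t} → inT (G X) i ≡ t → fI F i ≡ fI K i → fT F t ≡ fT K t
  agreeT-from-agreeI {i} refl same =
    trans (inT-comm F i) (trans (cong (inT (G Y)) same) (sym (inT-comm K i)))

  Disagree : Fin (nT (G X)) → Set
  Disagree t = fT F t ≢ fT K t

  disagreement-descends : ∀ t → Disagree t → ∃[ s ] (Disagree s × Step (G X) s t)
  disagreement-descends t differ
    with i , inT-i≡t ← etale-reflects-grounded (g-etale X) grounded t
    with output-or-initial X (inS (G X) i)
  ... | inj₂ (x , ex) =
        ⊥-elim (differ (agreeT-from-agreeI inT-i≡t (agreeI-from-agreeS i (agreeS-on-initial ex))))
  ... | inj₁ (o , eo) with fT F (outT (G X) o) ≟ fT K (outT (G X) o)
  ...   | yes same = ⊥-elim (differ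
            (agreeT-from-agreeI inT-i≡t (agreeI-from-agreeS i (agreeS-on-output eo same))))
  ...   | no  earlier = outT (G X) o , earlier , (o , i , refl , inT-i≡t , eo)

  agreeT : ∀ t → fT F t ≡ fT K t
  agreeT t with fT F t ≟ fT K t
  ... | yes same = same
  ... | no differ = ⊥-elim
        (acyclic⇒¬descending (G X) (acyclic X) Disagree disagreement-descends t differ)

  agreeS : ∀ a → fS F a ≡ fS K a
  agreeS a with output-or-initial X a
  ... | inj₁ (o , eo) = agreeS-on-output eo (agreeT _)
  ... | inj₂ (x , ex) = agreeS-on-initial ex

  procHom-unique : Agree F K
  procHom-unique = agreeS , (λ i → agreeI-from-agreeS i (agreeS _)) , agreeT , (λ o → agree-on-output o (agreeT _))

-- Part (2) holds for every endomorphism, automorphism or not: morphisms of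
-- processes are unique.
lemma9p4 : (P : Diagram) → Grounded P → (nB : ℕ) → (m : Fin nB → Fin (nS P)) →
    ((X Y : Process P nB m) (φ : ProcHom X Y) → InjectiveHom (h φ))
    × ((X : Process P nB m) (φ : ProcHom X X) → IsAutomorphism φ → IsIdentityHom (h φ))
lemma9p4 P grounded nB m =
  (λ X Y φ → procHom-injective grounded φ) ,
  (λ X φ _ → procHom-unique grounded φ (idProcHom X))
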